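{- Let $k\geq 1$ be an integer. Every graph $G$ with $n$ vertices and no $(k+1)$-clique has at most $\left(\frac{n}{k}+1\right)^k$ cliques.
   Context: All graphs are finite, simple and undirected. A clique is a (possibly empty) set of pairwise adjacent vertices; a $(k+1)$-clique is a clique of cardinality $k+1$. The number of cliques counts $\emptyset$ and single vertices. -}

module Defs where

open import Data.Nat using (ℕ; zero; suc)
open import Data.Fin using (Fin; zero; suc)
open import Data.Fin.Subset using (Subset; _∈_; ∣_∣; inside; outside)
open import Data.Fin.Subset.Properties using (_∈?_)
open import Data.Vec using (Vec; []; _∷_)
open import Data.List using (List; []; _∷_; map; _++_; filter; length)
open import Data.Product using (_×_)
open import Relation.Nullary using (¬_; Dec; yes; no)
open import Relation.Nullary.Decidable using (Dec; _→-dec_; ¬?)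
open import Relation.Binary.PropositionalEquality using (_≡_)
open import Data.Fin.Properties using (_≟_; all?)

record Graph (n : ℕ) : Set₁ where
  field
    Adj    : Fin n → Fin n → Set
    adj?   : ∀ i j → Dec (Adj i j)
    irrefl : ∀ i → ¬ Adj i i
    sym    : ∀ {i j} → Adj i j → Adj j i

open Graph public

IsClique : ∀ {n} → Graph n → Subset n → Set
IsClique G p = ∀ i j → i ∈ p → j ∈ p → ¬ (i ≡ j) → Adj G i j

isClique? : ∀ {n} (G : Graph n) (p : Subset n) → Dec (IsClique G p)
isClique? G p =
  all? λ i → all? λ j →
    (i ∈? p) →-dec ((j ∈? p) →-dec (¬? (i ≟ j) →-dec adj? G i j))

allSubsets : ∀ n → List (Subset n)
allSubsets zero    = [] ∷ []
allSubsets (suc n) = map (inside ∷_) (allSubsets n) ++ map (outside ∷_) (allSubsets n)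

-- The number of cliques of G (counting ∅ and single vertices).
numCliques : ∀ {n} → Graph n → ℕ
numCliques {n} G = length (filter (isClique? G) (allSubsets n))

NoCliqueOfSize : ∀ {n} → Graph n → ℕ → Set
NoCliqueOfSize G m = ∀ p → IsClique G p → ¬ (∣ p ∣ ≡ m)

-- Induction on k for the number c(S) of cliques inside a vertex set S.  Pick
-- v ∈ S of maximum degree Δ within S and delete the M = |S ∖ N(v)| vertices of
-- S outside N(v) one at a time: deleting u from T loses exactly the cliques
-- through u, of which there are c(T ∩ N(u)), and what finally remains lies in
-- S ∩ N(v).  Every S ∩ N(u) with u ∈ S has no k-clique and at most Δ vertices,
-- so by induction (k-1)^(k-1) c(S) ≤ (M + 1)(Δ + k - 1)^(k-1), and since
-- M + Δ = |S| the weighted AM–GM inequality turns this into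
-- k^k c(S) ≤ (|S| + k)^k.
module Submission where

import Algebra.Properties.CommutativeSemigroup as CommutativeSemigroupProperties
open import Data.Bool using (Bool; true; false; if_then_else_)
open import Data.Fin using (Fin; zero; suc)
open import Data.Fin.Properties using (_≟_)
open import Data.Fin.Subset
open import Data.Fin.Subset.Properties
open import Data.List as List using (map; _++_; filter; length; allFin)
open import Data.List.Properties using (length-++; filter-++)
open import Data.List.Membership.Propositional.Properties using (∈-allFin; ∈-filter⁺)
import Data.List.Relation.Unary.All as All
open import Data.List.Relation.Unary.All.Properties using (all-filter)
open import Data.Nat hiding (_≟_)
open import Data.Nat.Properties hiding (_≟_)
open import Data.List.Extrema ≤-totalOrder using (argmax; argmax-all; f[xs]≤f[argmax])
open import Data.Nat.Tactic.RingSolver using (solve-∀)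
open import Data.Product using (_×_; _,_; proj₁; proj₂; ∃)
open import Data.Sum using (inj₁; inj₂)
open import Data.Vec using ([]; _∷_; here; there; tabulate; _[_]≔_)
open import Data.Vec.Properties using (lookup∘tabulate; lookup⇒[]=; []=⇒lookup; []≔-updates; []≔-minimal)
open import Function using (_∘_)
open import Level using (0ℓ)
open import Relation.Binary.PropositionalEquality
open import Relation.Nullary using (¬_; Dec; yes; no; does; contradiction; ¬?; _×-dec_)
open import Relation.Nullary.Decidable using (dec-true)
open import Relation.Unary using (Pred; Decidable)

open import Defs hiding (sym)

module +-CS = CommutativeSemigroupProperties +-commutativeSemigroup
module *-CS = CommutativeSemigroupProperties *-commutativeSemigroup

private variable
  n : ℕ

^-distribʳ-* : ∀ m n o → (m * n) ^ o ≡ m ^ o * n ^ o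
^-distribʳ-* m n zero    = refl
^-distribʳ-* m n (suc o) = begin
  m * n * (m * n) ^ o      ≡⟨ cong (m * n *_) (^-distribʳ-* m n o) ⟩
  m * n * (m ^ o * n ^ o)  ≡⟨ *-CS.interchange m n (m ^ o) (n ^ o) ⟩
  m * m ^ o * (n * n ^ o)  ∎
  where open ≡-Reasoning

n^n≢0 : ∀ n → NonZero (n ^ n)
n^n≢0 zero    = _
n^n≢0 (suc n) = m^n≢0 (suc n) (suc n)

rearrangement : ∀ {a b c d} → a ≤ b → c ≤ d → a * d + b * c ≤ a * c + b * d
rearrangement {a} {c = c} a≤b c≤d
  with e , refl ← m≤n⇒∃[o]m+o≡n a≤b | f , refl ← m≤n⇒∃[o]m+o≡n c≤d =
  ≤-trans (m≤m+n (a * (c + f) + (a + e) * c) (e * f)) (≤-reflexive (expand a c e f))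
  where
  expand : ∀ a c e f → a * (c + f) + (a + e) * c + e * f ≡ a * c + (a + e) * (c + f)
  expand = solve-∀

x*y^m+y*x^m≤x^[1+m]+y^[1+m] : ∀ m x y → x * y ^ m + y * x ^ m ≤ x ^ suc m + y ^ suc m
x*y^m+y*x^m≤x^[1+m]+y^[1+m] m x y with ≤-total x y
... | inj₁ x≤y = rearrangement x≤y (^-monoˡ-≤ m x≤y)
... | inj₂ y≤x = subst₂ _≤_ (+-comm (y * x ^ m) _) (+-comm (y ^ suc m) _)
                        (rearrangement y≤x (^-monoˡ-≤ m y≤x))

[1+m]*x*y^m≤x^[1+m]+m*y^[1+m] : ∀ m x y → suc m * x * y ^ m ≤ x ^ suc m + m * y ^ suc m
[1+m]*x*y^m≤x^[1+m]+m*y^[1+m] zero    x y = ≤-reflexive (base x)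
  where
  base : ∀ x → 1 * x * 1 ≡ x * 1 + 0
  base = solve-∀
[1+m]*x*y^m≤x^[1+m]+m*y^[1+m] (suc m) x y = begin
  suc (suc m) * x * (y * yᵐ)                          ≡⟨ split m x y yᵐ ⟩
  y * (suc m * x * yᵐ) + x * (y * yᵐ)                 ≤⟨ +-monoˡ-≤ _ (*-monoʳ-≤ y ([1+m]*x*y^m≤x^[1+m]+m*y^[1+m] m x y)) ⟩
  y * (x * xᵐ + m * (y * yᵐ)) + x * (y * yᵐ)          ≡⟨ regroup m x y xᵐ yᵐ ⟩
  m * (y * (y * yᵐ)) + (x * (y * yᵐ) + y * (x * xᵐ))
    ≤⟨ +-monoʳ-≤ (m * (y * (y * yᵐ))) (x*y^m+y*x^m≤x^[1+m]+y^[1+m] (suc m) x y) ⟩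
  m * (y * (y * yᵐ)) + (x * (x * xᵐ) + y * (y * yᵐ))  ≡⟨ collect m x y xᵐ yᵐ ⟩
  x * (x * xᵐ) + suc m * (y * (y * yᵐ))               ∎
  where
  open ≤-Reasoning
  xᵐ = x ^ m
  yᵐ = y ^ m
  split : ∀ m x y yᵐ → suc (suc m) * x * (y * yᵐ) ≡ y * (suc m * x * yᵐ) + x * (y * yᵐ)
  split = solve-∀
  regroup : ∀ m x y xᵐ yᵐ → y * (x * xᵐ + m * (y * yᵐ)) + x * (y * yᵐ)
                           ≡ m * (y * (y * yᵐ)) + (x * (y * yᵐ) + y * (x * xᵐ))
  regroup = solve-∀
  collect : ∀ m x y xᵐ yᵐ → m * (y * (y * yᵐ)) + (x * (x * xᵐ) + y * (y * yᵐ))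
                           ≡ x * (x * xᵐ) + suc m * (y * (y * yᵐ))
  collect = solve-∀

-- AM–GM for a and j copies of b / j.
am-gm : ∀ j a b → suc j ^ suc j * (a * b ^ j) ≤ j ^ j * (a + b) ^ suc j
am-gm zero      a b = *-monoʳ-≤ 1 (*-monoˡ-≤ 1 (m≤m+n a b))
am-gm j@(suc _) a b = *-cancelˡ-≤ j (+-cancelʳ-≤ Z _ _ (begin
  j * (suc j ^ suc j * (a * b ^ j)) + Z            ≡⟨ lhs ⟩
  suc j * (j * (a + b)) * (suc j * b) ^ j           ≤⟨ [1+m]*x*y^m≤x^[1+m]+m*y^[1+m] j (j * (a + b)) (suc j * b) ⟩
  (j * (a + b)) ^ suc j + j * (suc j * b) ^ suc j   ≡⟨ rhs ⟩
  j * (j ^ j * (a + b) ^ suc j) + Z                 ∎))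
  where
  open ≤-Reasoning
  Z = j * (suc j ^ suc j * b ^ suc j)
  lhs : j * (suc j ^ suc j * (a * b ^ j)) + Z ≡ suc j * (j * (a + b)) * (suc j * b) ^ j
  lhs = trans (expand j (suc j ^ j) a b (b ^ j))
              (cong (suc j * (j * (a + b)) *_) (sym (^-distribʳ-* (suc j) b j)))
    where
    expand : ∀ j c a b bʲ → j * (suc j * c * (a * bʲ)) + j * (suc j * c * (b * bʲ))
                          ≡ suc j * (j * (a + b)) * (c * bʲ)
    expand = solve-∀
  rhs : (j * (a + b)) ^ suc j + j * (suc j * b) ^ suc j ≡ j * (j ^ j * (a + b) ^ suc j) + Z
  rhs = cong₂ (λ u v → u + j * v)
              (trans (^-distribʳ-* j (a + b) (suc j)) (*-assoc j (j ^ j) _))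
              (^-distribʳ-* (suc j) b (suc j))

∩-monoˡ-⊆ : ∀ {p q : Subset n} (r : Subset n) → p ⊆ q → p ∩ r ⊆ q ∩ r
∩-monoˡ-⊆ {p = p} r p⊆q x∈p∩r =
  x∈p∩q⁺ (p⊆q (proj₁ (x∈p∩q⁻ p r x∈p∩r)) , proj₂ (x∈p∩q⁻ p r x∈p∩r))

∣p∩q∣+∣p∩∁q∣≡∣p∣ : ∀ (p q : Subset n) → ∣ p ∩ q ∣ + ∣ p ∩ ∁ q ∣ ≡ ∣ p ∣
∣p∩q∣+∣p∩∁q∣≡∣p∣ []            []            = refl
∣p∩q∣+∣p∩∁q∣≡∣p∣ (inside  ∷ p) (inside  ∷ q) = cong suc (∣p∩q∣+∣p∩∁q∣≡∣p∣ p q)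
∣p∩q∣+∣p∩∁q∣≡∣p∣ (inside  ∷ p) (outside ∷ q) = trans (+-suc _ _) (cong suc (∣p∩q∣+∣p∩∁q∣≡∣p∣ p q))
∣p∩q∣+∣p∩∁q∣≡∣p∣ (outside ∷ p) (inside  ∷ q) = ∣p∩q∣+∣p∩∁q∣≡∣p∣ p q
∣p∩q∣+∣p∩∁q∣≡∣p∣ (outside ∷ p) (outside ∷ q) = ∣p∩q∣+∣p∩∁q∣≡∣p∣ p q

x∉p-x : ∀ {x : Fin n} {p} → x ∉ p - x
x∉p-x {x = zero}  {_ ∷ p} ()
x∉p-x {x = suc x} {_ ∷ p} (there x∈p-x) = x∉p-x x∈p-x

∣[p-x]∩q∣<∣p∩q∣ : ∀ {p q : Subset n} {x} → x ∈ p ∩ q → ∣ (p - x) ∩ q ∣ < ∣ p ∩ q ∣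
∣[p-x]∩q∣<∣p∩q∣ {p = p} {q} {x} x∈p∩q =
  p⊂q⇒∣p∣<∣q∣ (∩-monoˡ-⊆ q (p─q⊆p p ⁅ x ⁆) , x , x∈p∩q , x∉p-x ∘ proj₁ ∘ x∈p∩q⁻ (p - x) q)

x∈p⇒x∈p[y]≔inside : ∀ {x y : Fin n} {p} → y ∉ p → x ∈ p → x ∈ p [ y ]≔ inside
x∈p⇒x∈p[y]≔inside {x = x} {y} {p} y∉p x∈p = []≔-minimal p x y (λ { refl → y∉p x∈p }) x∈p

x∈p[y]≔b∧x≢y⇒x∈p : ∀ {x y : Fin n} {p b} → x ∈ p [ y ]≔ b → ¬ x ≡ y → x ∈ p
x∈p[y]≔b∧x≢y⇒x∈p {x = zero}  {zero}                 _          x≢y = contradiction refl x≢y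
x∈p[y]≔b∧x≢y⇒x∈p {x = zero}  {suc y} {_ ∷ p} here       _   = here
x∈p[y]≔b∧x≢y⇒x∈p {x = suc x} {zero}  {_ ∷ p} (there x∈) _   = there x∈
x∈p[y]≔b∧x≢y⇒x∈p {x = suc x} {suc y} {_ ∷ p} (there x∈) x≢y =
  there (x∈p[y]≔b∧x≢y⇒x∈p x∈ (x≢y ∘ cong suc))

p⊆q∧x∈q⇒p[x]≔inside⊆q : ∀ {p q : Subset n} {x} → p ⊆ q → x ∈ q → p [ x ]≔ inside ⊆ q
p⊆q∧x∈q⇒p[x]≔inside⊆q {x = x} p⊆q x∈q {i} i∈ with i ≟ x
... | yes refl = x∈q
... | no  i≢x  = p⊆q (x∈p[y]≔b∧x≢y⇒x∈p i∈ i≢x)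

∣p[x]≔inside∣≡1+∣p∣ : ∀ {x : Fin n} {p} → x ∉ p → ∣ p [ x ]≔ inside ∣ ≡ suc ∣ p ∣
∣p[x]≔inside∣≡1+∣p∣ {x = zero}  {inside  ∷ p} x∉p = contradiction here x∉p
∣p[x]≔inside∣≡1+∣p∣ {x = zero}  {outside ∷ p} x∉p = refl
∣p[x]≔inside∣≡1+∣p∣ {x = suc x} {inside  ∷ p} x∉p = cong suc (∣p[x]≔inside∣≡1+∣p∣ (x∉p ∘ there))
∣p[x]≔inside∣≡1+∣p∣ {x = suc x} {outside ∷ p} x∉p = ∣p[x]≔inside∣≡1+∣p∣ (x∉p ∘ there)

∃-argmax : (f : Fin n → ℕ) {S : Subset n} → Nonempty S →
  ∃ λ v → v ∈ S × (∀ {u} → u ∈ S → f u ≤ f v)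
∃-argmax {n} f {S} (w , w∈S) =
  argmax f w members ,
  argmax-all f w∈S (all-filter (_∈? S) (allFin n)) ,
  λ u∈S → All.lookup (f[xs]≤f[argmax] w members) (∈-filter⁺ (_∈? S) (∈-allFin _) u∈S)
  where members = filter (_∈? S) (allFin n)

countᵇ : (Subset n → Bool) → ℕ
countᵇ {n = zero}  f = if f [] then 1 else 0
countᵇ {n = suc n} f = countᵇ (f ∘ (inside ∷_)) + countᵇ (f ∘ (outside ∷_))

-- Counting only through `does` makes the count depend on the Boolean values of
-- the decider alone, so deciders built from `suc x ∈? s ∷ p` and from `x ∈? p`
-- have definitionally equal counts (last clause of count-split-at).
count : ∀ {P : Pred (Subset n) 0ℓ} → Decidable P → ℕ
count P? = countᵇ (does ∘ P?)

count-mono : ∀ {P Q : Pred (Subset n) 0ℓ} (P? : Decidable P) (Q? : Decidable Q) →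
  (∀ {p} → P p → Q p) → count P? ≤ count Q?
count-mono {n = zero} P? Q? P⇒Q with P? [] | Q? []
... | yes _   | yes _   = ≤-refl
... | yes P[] | no ¬Q[] = contradiction (P⇒Q P[]) ¬Q[]
... | no _    | _       = z≤n
count-mono {n = suc n} P? Q? P⇒Q =
  +-mono-≤ (count-mono (P? ∘ (inside ∷_)) (Q? ∘ (inside ∷_)) P⇒Q)
           (count-mono (P? ∘ (outside ∷_)) (Q? ∘ (outside ∷_)) P⇒Q)

count≡0 : ∀ {P : Pred (Subset n) 0ℓ} (P? : Decidable P) → (∀ p → ¬ P p) → count P? ≡ 0
count≡0 {n = zero} P? ¬P with P? []
... | yes P[] = contradiction P[] (¬P [])
... | no _    = refl
count≡0 {n = suc n} P? ¬P =
  cong₂ _+_ (count≡0 (P? ∘ (inside ∷_)) (¬P ∘ (inside ∷_)))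
            (count≡0 (P? ∘ (outside ∷_)) (¬P ∘ (outside ∷_)))

count≤1 : ∀ {P : Pred (Subset n) 0ℓ} (P? : Decidable P) → (∀ {p} → P p → Empty p) → count P? ≤ 1
count≤1 {n = zero} P? _ with P? []
... | yes _ = ≤-refl
... | no _  = z≤n
count≤1 {n = suc n} P? P⇒Empty = begin
  count (P? ∘ (inside ∷_)) + count (P? ∘ (outside ∷_))
    ≡⟨ cong (_+ count (P? ∘ (outside ∷_)))
            (count≡0 (P? ∘ (inside ∷_)) λ _ P[p] → P⇒Empty P[p] (zero , here)) ⟩
  count (P? ∘ (outside ∷_))
    ≤⟨ count≤1 (P? ∘ (outside ∷_)) (drop-∷-Empty ∘ P⇒Empty) ⟩
  1 ∎
  where open ≤-Reasoning

count-split-at : ∀ {P : Pred (Subset n) 0ℓ} (x : Fin n) (P? : Decidable P) →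
  count P? ≤ count (λ p → ¬? (x ∈? p) ×-dec P? p) + count (λ p → ¬? (x ∈? p) ×-dec P? (p [ x ]≔ inside))
count-split-at {n = suc n} {P} zero P? = begin
  count (P? ∘ (inside ∷_)) + count (P? ∘ (outside ∷_))
    ≤⟨ +-mono-≤ (count-mono (P? ∘ (inside ∷_)) (Q? inside) ((λ ()) ,_))
                (count-mono (P? ∘ (outside ∷_)) (Q? outside) ((λ ()) ,_)) ⟩
  added outside + kept outside
    ≡⟨ +-comm (added outside) (kept outside) ⟩
  kept outside + added outside
    ≤⟨ +-mono-≤ (m≤n+m _ (kept inside)) (m≤n+m _ (added inside)) ⟩
  (kept inside + kept outside) + (added inside + added outside) ∎
  where
  open ≤-Reasoning
  Q? : ∀ s → Decidable (λ p → zero ∉ outside ∷ p × P (s ∷ p))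
  Q? s p = ¬? (zero ∈? outside ∷ p) ×-dec P? (s ∷ p)
  kept added : Side → ℕ
  kept  s = count (λ p → ¬? (zero ∈? s ∷ p) ×-dec P? (s ∷ p))
  added s = count (λ p → ¬? (zero ∈? s ∷ p) ×-dec P? (inside ∷ p))
count-split-at {n = suc n} (suc x) P? = begin
  count (P? ∘ (inside ∷_)) + count (P? ∘ (outside ∷_))
    ≤⟨ +-mono-≤ (count-split-at x (P? ∘ (inside ∷_))) (count-split-at x (P? ∘ (outside ∷_))) ⟩
  (kept inside + added inside) + (kept outside + added outside)
    ≡⟨ +-CS.interchange (kept inside) (added inside) (kept outside) (added outside) ⟩
  (kept inside + kept outside) + (added inside + added outside) ∎
  where
  open ≤-Reasoning
  kept added : Side → ℕ
  kept  s = count (λ p → ¬? (x ∈? p) ×-dec P? (s ∷ p))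
  added s = count (λ p → ¬? (x ∈? p) ×-dec P? (s ∷ p [ x ]≔ inside))

length-filter-map : ∀ {A B : Set} {P : Pred B 0ℓ} (P? : Decidable P) (f : A → B) xs →
  length (filter P? (map f xs)) ≡ length (filter (P? ∘ f) xs)
length-filter-map P? f List.[]         = refl
length-filter-map P? f (x List.∷ xs) with does (P? (f x))
... | true  = cong suc (length-filter-map P? f xs)
... | false = length-filter-map P? f xs

length-filter-allSubsets : ∀ n {P : Pred (Subset n) 0ℓ} (P? : Decidable P) →
  length (filter P? (allSubsets n)) ≡ count P?
length-filter-allSubsets zero    P? with does (P? [])
... | true  = refl
... | false = refl
length-filter-allSubsets (suc n) P? = begin
  length (filter P? (map (inside ∷_) (allSubsets n) ++ map (outside ∷_) (allSubsets n)))
    ≡⟨ cong length (filter-++ P? (map (inside ∷_) (allSubsets n)) _) ⟩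
  length (filter P? (map (inside ∷_) (allSubsets n)) ++ filter P? (map (outside ∷_) (allSubsets n)))
    ≡⟨ length-++ (filter P? (map (inside ∷_) (allSubsets n))) ⟩
  length (filter P? (map (inside ∷_) (allSubsets n))) + length (filter P? (map (outside ∷_) (allSubsets n)))
    ≡⟨ cong₂ _+_ (half inside) (half outside) ⟩
  count (P? ∘ (inside ∷_)) + count (P? ∘ (outside ∷_)) ∎
  where
  open ≡-Reasoning
  half : ∀ s → length (filter P? (map (s ∷_) (allSubsets n))) ≡ count (P? ∘ (s ∷_))
  half s = trans (length-filter-map P? (s ∷_) (allSubsets n)) (length-filter-allSubsets n (P? ∘ (s ∷_)))

module _ {n} (G : Graph n) where

  N : Fin n → Subset n
  N u = tabulate (does ∘ adj? G u)

  ∈N⁺ : ∀ {u i} → Adj G u i → i ∈ N u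
  ∈N⁺ {u} {i} u~i = lookup⇒[]= i (N u) (trans (lookup∘tabulate _ i) (dec-true (adj? G u i) u~i))

  ∈N⁻ : ∀ {u i} → i ∈ N u → Adj G u i
  ∈N⁻ {u} {i} i∈N with adj? G u i | trans (sym (lookup∘tabulate _ i)) ([]=⇒lookup i∈N)
  ... | yes u~i | _  = u~i
  ... | no  _   | ()

  CliqueIn : Subset n → Subset n → Set
  CliqueIn T p = p ⊆ T × IsClique G p

  cliqueIn? : ∀ T p → Dec (CliqueIn T p)
  cliqueIn? T p = (p ⊆? T) ×-dec isClique? G p

  cliqueCount : Subset n → ℕ
  cliqueCount T = count (cliqueIn? T)

  NoCliqueOfSizeIn : ℕ → Subset n → Set
  NoCliqueOfSizeIn m S = ∀ p → p ⊆ S → IsClique G p → ¬ ∣ p ∣ ≡ m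

  IsClique-insert : ∀ {p u} → IsClique G p → (∀ {i} → i ∈ p → Adj G u i) →
    IsClique G (p [ u ]≔ inside)
  IsClique-insert {p} {u} p-clique u~p i j i∈ j∈ i≢j with i ≟ u | j ≟ u
  ... | yes refl | yes refl = contradiction refl i≢j
  ... | yes refl | no j≢u   = u~p (x∈p[y]≔b∧x≢y⇒x∈p j∈ j≢u)
  ... | no i≢u   | yes refl = Graph.sym G (u~p (x∈p[y]≔b∧x≢y⇒x∈p i∈ i≢u))
  ... | no i≢u   | no j≢u   =
    p-clique i j (x∈p[y]≔b∧x≢y⇒x∈p i∈ i≢u) (x∈p[y]≔b∧x≢y⇒x∈p j∈ j≢u) i≢j

  cliqueCount-mono : ∀ {T T′} → T ⊆ T′ → cliqueCount T ≤ cliqueCount T′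
  cliqueCount-mono T⊆T′ =
    count-mono (cliqueIn? _) (cliqueIn? _) λ (p⊆T , p-clique) → T⊆T′ ∘ p⊆T , p-clique

  cliqueCount≤1 : ∀ {T} → Empty T → cliqueCount T ≤ 1
  cliqueCount≤1 T-empty = count≤1 (cliqueIn? _) λ (p⊆T , _) (i , i∈p) → T-empty (i , p⊆T i∈p)

  cliqueCount-delete : ∀ {T u} → u ∈ T → cliqueCount T ≤ cliqueCount (T - u) + cliqueCount (T ∩ N u)
  cliqueCount-delete {T} {u} u∈T = ≤-trans (count-split-at u (cliqueIn? T))
    (+-mono-≤ (count-mono (λ p → ¬? (u ∈? p) ×-dec cliqueIn? T p) (cliqueIn? (T - u)) without-u)
              (count-mono (λ p → ¬? (u ∈? p) ×-dec cliqueIn? T (p [ u ]≔ inside)) (cliqueIn? (T ∩ N u)) with-u))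
    where
    without-u : ∀ {p} → u ∉ p × CliqueIn T p → CliqueIn (T - u) p
    without-u (u∉p , p⊆T , p-clique) =
      (λ i∈p → x∈p∧x≢y⇒x∈p-y (p⊆T i∈p) λ { refl → u∉p i∈p }) , p-clique
    with-u : ∀ {p} → u ∉ p × CliqueIn T (p [ u ]≔ inside) → CliqueIn (T ∩ N u) p
    with-u {p} (u∉p , p+u⊆T , p+u-clique) =
      (λ i∈p → x∈p∩q⁺ (p+u⊆T (grow i∈p) ,
                        ∈N⁺ (p+u-clique u _ ([]≔-updates p u) (grow i∈p) λ { refl → u∉p i∈p }))) ,
      λ i j i∈p j∈p → p+u-clique i j (grow i∈p) (grow j∈p)
      where
      grow : ∀ {i} → i ∈ p → i ∈ p [ u ]≔ inside
      grow = x∈p⇒x∈p[y]≔inside u∉p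

  noCliqueOfSizeIn-N : ∀ {j S u} → NoCliqueOfSizeIn (2+ j) S → u ∈ S → NoCliqueOfSizeIn (suc j) (S ∩ N u)
  noCliqueOfSizeIn-N {S = S} {u} no-clique u∈S p p⊆S∩Nu p-clique ∣p∣≡1+j =
    no-clique (p [ u ]≔ inside)
              (p⊆q∧x∈q⇒p[x]≔inside⊆q (proj₁ ∘ x∈p∩q⁻ S (N u) ∘ p⊆S∩Nu) u∈S)
              (IsClique-insert p-clique u~p)
              (trans (∣p[x]≔inside∣≡1+∣p∣ (irrefl G u ∘ u~p)) (cong suc ∣p∣≡1+j))
    where
    u~p : ∀ {i} → i ∈ p → Adj G u i
    u~p = ∈N⁻ ∘ proj₂ ∘ x∈p∩q⁻ S (N u) ∘ p⊆S∩Nu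

  noCliqueOfSizeIn1⇒Empty : ∀ {S} → NoCliqueOfSizeIn 1 S → Empty S
  noCliqueOfSizeIn1⇒Empty {S} no-clique (i , i∈S) =
    no-clique ⁅ i ⁆ (λ x∈ → subst (_∈ S) (sym (x∈⁅y⁆⇒x≡y i x∈)) i∈S) singleton-clique (∣⁅x⁆∣≡1 i)
    where
    singleton-clique : IsClique G ⁅ i ⁆
    singleton-clique a b a∈ b∈ a≢b =
      contradiction (trans (x∈⁅y⁆⇒x≡y i a∈) (sym (x∈⁅y⁆⇒x≡y i b∈))) a≢b

  cliqueCount-restrict : ∀ A w {B} m {T} → ∣ T ∩ ∁ A ∣ ≤ m →
    (∀ {u} → u ∈ T → w * cliqueCount (T ∩ N u) ≤ B) →
    w * cliqueCount T ≤ w * cliqueCount (T ∩ A) + m * B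
  cliqueCount-restrict A w m {T} _ _ with nonempty? (T ∩ ∁ A)
  ... | no T∖A-empty = ≤-trans (*-monoʳ-≤ w (cliqueCount-mono T⊆T∩A)) (m≤m+n _ _)
    where
    T⊆T∩A : T ⊆ T ∩ A
    T⊆T∩A i∈T = x∈p∩q⁺ (i∈T , x∉∁p⇒x∈p λ i∈∁A → T∖A-empty (_ , x∈p∩q⁺ (i∈T , i∈∁A)))
  cliqueCount-restrict A w zero size _ | yes (u , u∈T∖A) =
    contradiction (<-≤-trans (∣[p-x]∩q∣<∣p∩q∣ u∈T∖A) size) n≮0
  cliqueCount-restrict A w {B} (suc m) {T} size bound | yes (u , u∈T∖A) = begin
    w * cliqueCount T
      ≤⟨ *-monoʳ-≤ w (cliqueCount-delete u∈T) ⟩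
    w * (cliqueCount (T - u) + cliqueCount (T ∩ N u))
      ≡⟨ *-distribˡ-+ w _ _ ⟩
    w * cliqueCount (T - u) + w * cliqueCount (T ∩ N u)
      ≤⟨ +-mono-≤ (cliqueCount-restrict A w m (s≤s⁻¹ (<-≤-trans (∣[p-x]∩q∣<∣p∩q∣ u∈T∖A) size)) bound′)
                  (bound u∈T) ⟩
    w * cliqueCount ((T - u) ∩ A) + m * B + B
      ≤⟨ +-monoˡ-≤ B (+-monoˡ-≤ (m * B) (*-monoʳ-≤ w (cliqueCount-mono (∩-monoˡ-⊆ A T-u⊆T)))) ⟩
    w * cliqueCount (T ∩ A) + m * B + B
      ≡⟨ +-assoc _ (m * B) B ⟩
    w * cliqueCount (T ∩ A) + (m * B + B)
      ≡⟨ cong (w * cliqueCount (T ∩ A) +_) (+-comm (m * B) B) ⟩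
    w * cliqueCount (T ∩ A) + suc m * B ∎
    where
    open ≤-Reasoning
    u∈T = proj₁ (x∈p∩q⁻ T (∁ A) u∈T∖A)
    T-u⊆T : T - u ⊆ T
    T-u⊆T = p─q⊆p T ⁅ u ⁆
    bound′ : ∀ {v} → v ∈ T - u → w * cliqueCount ((T - u) ∩ N v) ≤ B
    bound′ v∈ = ≤-trans (*-monoʳ-≤ w (cliqueCount-mono (∩-monoˡ-⊆ _ T-u⊆T))) (bound (T-u⊆T v∈))

  cliqueCount-bound : ∀ k {S} → NoCliqueOfSizeIn (suc k) S → k ^ k * cliqueCount S ≤ (∣ S ∣ + k) ^ k
  cliqueCount-bound zero no-clique =
    ≤-trans (≤-reflexive (*-identityˡ _)) (cliqueCount≤1 (noCliqueOfSizeIn1⇒Empty no-clique))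
  cliqueCount-bound (suc j) {S} no-clique with nonempty? S
  ... | no S-empty = begin
    suc j ^ suc j * cliqueCount S  ≤⟨ *-monoʳ-≤ (suc j ^ suc j) (cliqueCount≤1 S-empty) ⟩
    suc j ^ suc j * 1              ≡⟨ *-identityʳ _ ⟩
    suc j ^ suc j                  ≤⟨ ^-monoˡ-≤ (suc j) (m≤n+m (suc j) ∣ S ∣) ⟩
    (∣ S ∣ + suc j) ^ suc j        ∎
    where open ≤-Reasoning
  ... | yes S-nonempty with ∃-argmax (λ u → ∣ S ∩ N u ∣) S-nonempty
  ...   | v , v∈S , maximal = *-cancelˡ-≤ (j ^ j) {{n^n≢0 j}} (begin
    j ^ j * (suc j ^ suc j * cliqueCount S)  ≡⟨ *-CS.x∙yz≈y∙xz (j ^ j) (suc j ^ suc j) (cliqueCount S) ⟩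
    suc j ^ suc j * (j ^ j * cliqueCount S)  ≤⟨ *-monoʳ-≤ (suc j ^ suc j) restricted ⟩
    suc j ^ suc j * (suc M * (Δ + j) ^ j)    ≤⟨ am-gm j (suc M) (Δ + j) ⟩
    j ^ j * (suc M + (Δ + j)) ^ suc j        ≡⟨ cong (λ s → j ^ j * s ^ suc j) size ⟩
    j ^ j * (∣ S ∣ + suc j) ^ suc j          ∎)
    where
    open ≤-Reasoning
    Δ = ∣ S ∩ N v ∣
    M = ∣ S ∩ ∁ (N v) ∣
    bound : ∀ {u} → u ∈ S → j ^ j * cliqueCount (S ∩ N u) ≤ (Δ + j) ^ j
    bound u∈S = ≤-trans (cliqueCount-bound j (noCliqueOfSizeIn-N no-clique u∈S))
                        (^-monoˡ-≤ j (+-monoˡ-≤ j (maximal u∈S)))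
    restricted : j ^ j * cliqueCount S ≤ suc M * (Δ + j) ^ j
    restricted = ≤-trans (cliqueCount-restrict (N v) (j ^ j) M ≤-refl bound) (+-monoˡ-≤ (M * _) (bound v∈S))
    size : suc M + (Δ + j) ≡ ∣ S ∣ + suc j
    size = trans (regroup Δ M j) (cong (_+ suc j) (∣p∩q∣+∣p∩∁q∣≡∣p∣ S (N v)))
      where
      regroup : ∀ Δ M j → suc M + (Δ + j) ≡ Δ + M + suc j
      regroup = solve-∀

proposition9 : (k : ℕ) → 1 ≤ k → (n : ℕ) → (G : Graph n) →
    NoCliqueOfSize G (suc k) →
    k ^ k * numCliques G ≤ (n + k) ^ k
proposition9 k _ n G no-clique = begin
  k ^ k * numCliques G         ≡⟨ cong (k ^ k *_) (length-filter-allSubsets n (isClique? G)) ⟩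
  k ^ k * count (isClique? G)  ≤⟨ *-monoʳ-≤ (k ^ k) (count-mono (isClique? G) (cliqueIn? G ⊤) ((λ _ → ∈⊤) ,_)) ⟩
  k ^ k * cliqueCount G ⊤      ≤⟨ cliqueCount-bound G k (λ p _ → no-clique p) ⟩
  (∣ ⊤ {n} ∣ + k) ^ k          ≡⟨ cong (λ m → (m + k) ^ k) (∣⊤∣≡n n) ⟩
  (n + k) ^ k                  ∎
  where open ≤-Reasoning
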